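{- Let $n$ be a positive integer and let $\sigma(i,j,k)$ and $\sigma(i',j',k')$ be block transpositions on $[n]$. In each of the following cases, $\{\sigma(i,j,k),\sigma(i',j',k')\}$ is an edge of $\mathrm{Cay}(\mathrm{Sym}_n,T_n)$: (i) $(i',j')=(i,j)$ and $k\ne k'$; (ii) $(i',j')=(j,k)$ and $k<k'$; (iii) $(j',k')=(j,k)$ and $i\ne i'$; (iv) $(j',k')=(i,j)$ and $i'<i$; (v) $(i',k')=(i,k)$ and $j\ne j'$.
   Context: $\mathrm{Sym}_n$ is the symmetric group on $[n]$, permutations in one-line notation, $(\pi\circ\rho)(t)=\pi(\rho(t))$. For integers $0\le i<j<k\le n$ the block transposition $\sigma(i,j,k)$ is $[1\cdots i\ \ j+1\cdots k\ \ i+1\cdots j\ \ k+1\cdots n]$; $T_n$ is the set of all block transpositions. $\mathrm{Cay}(\mathrm{Sym}_n,T_n)$ has vertex set $\mathrm{Sym}_n$, with $\pi\sim\rho$ iff $\rho=\pi\circ\sigma$ for some $\sigma\in T_n$. -}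

module Defs where

open import Data.Nat using (ℕ; _+_; _∸_; _≤_; _<_)
open import Data.Nat.Properties using (_≤?_)
open import Data.Product using (Σ; _×_; ∃-syntax)
open import Data.Bool using (if_then_else_)
open import Relation.Nullary.Decidable using (⌊_⌋)
open import Relation.Binary.PropositionalEquality using (_≡_)

-- A permutation of [n] in one-line notation is represented as a function
-- ℕ → ℕ of which only the values at positions 1..n matter.

IsBT : ℕ → ℕ → ℕ → ℕ → Set
IsBT n i j k = (i < j) × (j < k) × (k ≤ n)

-- σ(i,j,k) = [1 ⋯ i  j+1 ⋯ k  i+1 ⋯ j  k+1 ⋯ n]  (position t ↦ entry)
σ : ℕ → ℕ → ℕ → ℕ → ℕ
σ i j k t =
  if ⌊ t ≤? i ⌋ then t
  else if ⌊ t ≤? i + (k ∸ j) ⌋ then t + (j ∸ i)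
  else if ⌊ t ≤? k ⌋ then t ∸ (k ∸ j)
  else t

_≈[_]_ : (ℕ → ℕ) → ℕ → (ℕ → ℕ) → Set
π ≈[ n ] ρ = ∀ t → 1 ≤ t → t ≤ n → π t ≡ ρ t

Adj : ℕ → (ℕ → ℕ) → (ℕ → ℕ) → Set
Adj n π ρ = ∃[ a ] ∃[ b ] ∃[ c ] (IsBT n a b c × (ρ ≈[ n ] (λ t → π (σ a b c t))))

-- Write a permutation in one-line notation as a word of blocks, each block
-- contributing a run of consecutive entries. Precomposing with σ(i,j,k)
-- exchanges the two adjacent segments of a word that occupy the positions
-- i+1 … j and j+1 … k. In each case of the lemma the indices involved are
-- four boundaries p < q < r < s, both permutations are rearrangements of the
-- four blocks into which p, q, r cut [1 … s], and one rearrangement arises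
-- from the other by exchanging two adjacent segments. Exchanging is
-- symmetric, which disposes of the cases k′ < k, i < i′ and j′ < j.

module Submission where

open import Defs
open import Data.Nat using (ℕ; _+_; _∸_; _≤_; _<_; _≤?_; s≤s)
open import Data.Nat.Properties
open import Data.Nat.Tactic.RingSolver using (solve)
open import Algebra.Properties.CommutativeSemigroup +-commutativeSemigroup
  using (xy∙z≈x∙zy; x∙yz≈y∙xz; xy∙z≈xz∙y)
open import Data.Bool using (if_then_else_)
open import Data.List using (List; []; _∷_; _++_)
open import Data.Nat.ListAction using (sum)
open import Data.Product using (_×_; _,_)
open import Data.Sum using (_⊎_; inj₁; inj₂)
open import Function using (_∘_)
open import Relation.Nullary using (yes; no; contradiction)
open import Relation.Nullary.Decidable using (⌊_⌋)
open import Relation.Binary.Definitions using (tri<; tri≈; tri>)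
open import Relation.Binary.PropositionalEquality
open ≡-Reasoning

infix 4 _≗⁺_

_≗⁺_ : (ℕ → ℕ) → (ℕ → ℕ) → Set
f ≗⁺ g = ∀ {t} → 0 < t → f t ≡ g t

if-≤ : ∀ {A : Set} {t m} {a b : A} → t ≤ m → (if ⌊ t ≤? m ⌋ then a else b) ≡ a
if-≤ {t = t} {m} t≤m with t ≤? m
... | yes _ = refl
... | no t≰m = contradiction t≤m t≰m

if-> : ∀ {A : Set} {t m} {a b : A} → m < t → (if ⌊ t ≤? m ⌋ then a else b) ≡ b
if-> {t = t} {m} m<t with t ≤? m
... | yes t≤m = contradiction t≤m (<⇒≱ m<t)
... | no _ = refl

data Cut (m : ℕ) : ℕ → Set where
  below : ∀ {t} → t ≤ m → Cut m t
  above : ∀ {s} → 0 < s → Cut m (m + s)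

cut : ∀ m t → Cut m t
cut m t with t ≤? m
... | yes t≤m = below t≤m
... | no t≰m = subst (Cut m) (m+[n∸m]≡n (<⇒≤ m<t)) (above (m<n⇒0<n∸m m<t))
  where
  m<t : m < t
  m<t = ≰⇒> t≰m

-- A word with tail e lists a permutation in one-line notation block by
-- block: the block (o , l) contributes the entries o + 1 … o + l, and the
-- position span w + t after the last block holds the entry e + t.
Block : Set
Block = ℕ × ℕ

Word : Set
Word = List Block

⟦_⟧ : Word → ℕ → ℕ → ℕ
⟦ [] ⟧ e t = e + t
⟦ (o , l) ∷ w ⟧ e t = if ⌊ t ≤? l ⌋ then o + t else ⟦ w ⟧ e (t ∸ l)

-- The singleton clause keeps the span of a concrete word free of a
-- trailing + 0, so that spans match the boundaries of σ literally.
span : Word → ℕ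
span [] = 0
span ((_ , l) ∷ []) = l
span ((_ , l) ∷ w@(_ ∷ _)) = l + span w

⟦⟧-∷-above : ∀ o l w {e s} → 0 < s → ⟦ (o , l) ∷ w ⟧ e (l + s) ≡ ⟦ w ⟧ e s
⟦⟧-∷-above o l w {e} {s} 0<s =
  trans (if-> (m<m+n l 0<s)) (cong (⟦ w ⟧ e) (m+n∸m≡n l s))

span-∷ : ∀ o l w → span ((o , l) ∷ w) ≡ l + span w
span-∷ o l [] = sym (+-identityʳ l)
span-∷ o l (_ ∷ _) = refl

⟦⟧-++-skip : ∀ u {v e s} → 0 < s → ⟦ u ++ v ⟧ e (span u + s) ≡ ⟦ v ⟧ e s
⟦⟧-++-skip [] _ = refl
⟦⟧-++-skip ((o , l) ∷ u) {v} {e} {s} 0<s = begin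
  ⟦ (o , l) ∷ u ++ v ⟧ e (span ((o , l) ∷ u) + s) ≡⟨ cong (λ p → ⟦ (o , l) ∷ u ++ v ⟧ e (p + s)) (span-∷ o l u) ⟩
  ⟦ (o , l) ∷ u ++ v ⟧ e (l + span u + s)         ≡⟨ cong (⟦ (o , l) ∷ u ++ v ⟧ e) (+-assoc l (span u) s) ⟩
  ⟦ (o , l) ∷ u ++ v ⟧ e (l + (span u + s))       ≡⟨ ⟦⟧-∷-above o l (u ++ v) (m≤n⇒m≤o+n (span u) 0<s) ⟩
  ⟦ u ++ v ⟧ e (span u + s)                       ≡⟨ ⟦⟧-++-skip u 0<s ⟩
  ⟦ v ⟧ e s                                       ∎

⟦⟧-++-within : ∀ u {v v′ e e′ t} → 0 < t → t ≤ span u →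
               ⟦ u ++ v ⟧ e t ≡ ⟦ u ++ v′ ⟧ e′ t
⟦⟧-++-within [] (s≤s _) ()
⟦⟧-++-within ((o , l) ∷ u) {v} {v′} {t = t} 0<t t≤span with cut l t
... | below t≤l = trans (if-≤ t≤l) (sym (if-≤ t≤l))
... | above 0<s = trans (⟦⟧-∷-above o l (u ++ v) 0<s)
  (trans (⟦⟧-++-within u 0<s (+-cancelˡ-≤ l _ _ (≤-trans t≤span (≤-reflexive (span-∷ o l u)))))
         (sym (⟦⟧-∷-above o l (u ++ v′) 0<s)))

segments : ℕ → List ℕ → Word
segments o [] = []
segments o (l ∷ ls) = (o , l) ∷ segments (o + l) ls

segments-translation : ∀ o ls → (o +_) ≗⁺ ⟦ segments o ls ⟧ (o + sum ls)
segments-translation o [] {t} _ = cong (_+ t) (sym (+-identityʳ o))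
segments-translation o (l ∷ ls) {t} 0<t with cut l t
... | below t≤l = sym (if-≤ t≤l)
... | above {s} 0<s = begin
  o + (l + s)                                    ≡⟨ +-assoc o l s ⟨
  o + l + s                                      ≡⟨ segments-translation (o + l) ls 0<s ⟩
  ⟦ segments (o + l) ls ⟧ (o + l + sum ls) s     ≡⟨ cong (λ e → ⟦ segments (o + l) ls ⟧ e s) (+-assoc o l (sum ls)) ⟩
  ⟦ segments (o + l) ls ⟧ (o + (l + sum ls)) s   ≡⟨ ⟦⟧-∷-above o l (segments (o + l) ls) 0<s ⟨
  ⟦ segments o (l ∷ ls) ⟧ (o + sum (l ∷ ls)) (l + s) ∎

σ-fixed-below : ∀ {i j k t} → t ≤ i → σ i j k t ≡ t
σ-fixed-below = if-≤

σ-fixed-above : ∀ {i j k t} → i ≤ j → j ≤ k → k < t → σ i j k t ≡ t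
σ-fixed-above {i} {j} {k} {t} i≤j j≤k k<t =
  trans (if-> (≤-<-trans i≤k k<t)) (trans (if-> (≤-<-trans i+[k∸j]≤k k<t)) (if-> k<t))
  where
  i+[k∸j]≤k : i + (k ∸ j) ≤ k
  i+[k∸j]≤k = ≤-trans (+-monoˡ-≤ (k ∸ j) i≤j) (≤-reflexive (m+[n∸m]≡n j≤k))
  i≤k : i ≤ k
  i≤k = ≤-trans (m≤m+n i (k ∸ j)) i+[k∸j]≤k

σ-lengths : ∀ P Q R t → σ P (P + Q) (P + Q + R) t ≡
  (if ⌊ t ≤? P ⌋ then t else if ⌊ t ≤? P + R ⌋ then t + Q
   else if ⌊ t ≤? P + Q + R ⌋ then t ∸ R else t)
σ-lengths P Q R t = cong₂
  (λ r q → if ⌊ t ≤? P ⌋ then t else if ⌊ t ≤? P + r ⌋ then t + q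
           else if ⌊ t ≤? P + Q + R ⌋ then t ∸ r else t)
  (m+n∸m≡n (P + Q) R) (m+n∸m≡n P Q)

σ-at-right-block : ∀ P Q R {s} → 0 < s → s ≤ R → σ P (P + Q) (P + Q + R) (P + s) ≡ P + (Q + s)
σ-at-right-block P Q R {s} 0<s s≤R = begin
  σ P (P + Q) (P + Q + R) (P + s) ≡⟨ σ-lengths P Q R (P + s) ⟩
  _                               ≡⟨ if-> (m<m+n P 0<s) ⟩
  _                               ≡⟨ if-≤ (+-monoʳ-≤ P s≤R) ⟩
  P + s + Q                       ≡⟨ xy∙z≈x∙zy P s Q ⟩
  P + (Q + s)                     ∎

σ-at-left-block : ∀ P Q R {s} → 0 < s → s ≤ Q → σ P (P + Q) (P + Q + R) (P + (R + s)) ≡ P + s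
σ-at-left-block P Q R {s} 0<s s≤Q = begin
  σ P (P + Q) (P + Q + R) (P + (R + s)) ≡⟨ σ-lengths P Q R (P + (R + s)) ⟩
  _                                     ≡⟨ if-> (m<m+n P (m≤n⇒m≤o+n R 0<s)) ⟩
  _                                     ≡⟨ if-> (+-monoʳ-< P (m<m+n R 0<s)) ⟩
  _                                     ≡⟨ if-≤ P+[R+s]≤P+Q+R ⟩
  P + (R + s) ∸ R                       ≡⟨ cong (_∸ R) (x∙yz≈y∙xz P R s) ⟩
  R + (P + s) ∸ R                       ≡⟨ m+n∸m≡n R (P + s) ⟩
  P + s                                 ∎
  where
  P+[R+s]≤P+Q+R : P + (R + s) ≤ P + Q + R
  P+[R+s]≤P+Q+R = subst₂ _≤_ (cong (P +_) (+-comm s R)) (sym (+-assoc P Q R))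
                          (+-monoʳ-≤ P (+-monoˡ-≤ R s≤Q))

σ-after-blocks : ∀ P Q R {s} → 0 < s → σ P (P + Q) (P + Q + R) (P + (R + (Q + s))) ≡ P + (Q + (R + s))
σ-after-blocks P Q R {s} 0<s = begin
  σ P (P + Q) (P + Q + R) (P + (R + (Q + s))) ≡⟨ σ-fixed-above (m≤m+n P Q) (m≤m+n (P + Q) R) P+Q+R<t ⟩
  P + (R + (Q + s))                          ≡⟨ cong (P +_) (x∙yz≈y∙xz R Q s) ⟩
  P + (Q + (R + s))                          ∎
  where
  rearranged : P + Q + R + s ≡ P + (R + (Q + s))
  rearranged = solve (P ∷ Q ∷ R ∷ s ∷ [])
  P+Q+R<t : P + Q + R < P + (R + (Q + s))
  P+Q+R<t = subst (P + Q + R <_) rearranged (m<m+n (P + Q + R) 0<s)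

module _ (w₁ w₂ w₃ w₄ : Word) where
  private
    P Q R : ℕ
    P = span w₁
    Q = span w₂
    R = span w₃

  swap-≗⁺ : ∀ {e f} → f ≗⁺ ⟦ w₁ ++ w₂ ++ w₃ ++ w₄ ⟧ e →
            f ∘ σ (span w₁) (span w₁ + span w₂) (span w₁ + span w₂ + span w₃)
              ≗⁺ ⟦ w₁ ++ w₃ ++ w₂ ++ w₄ ⟧ e
  swap-≗⁺ {e} {f} f≗ {t} 0<t with cut P t
  ... | below t≤P = begin
    f (σ P (P + Q) (P + Q + R) t) ≡⟨ cong f (σ-fixed-below t≤P) ⟩
    f t                           ≡⟨ f≗ 0<t ⟩
    ⟦ w₁ ++ w₂ ++ w₃ ++ w₄ ⟧ e t  ≡⟨ ⟦⟧-++-within w₁ 0<t t≤P ⟩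
    ⟦ w₁ ++ w₃ ++ w₂ ++ w₄ ⟧ e t  ∎
  ... | above {s} 0<s with cut R s
  ...   | below s≤R = begin
    f (σ P (P + Q) (P + Q + R) (P + s))      ≡⟨ cong f (σ-at-right-block P Q R 0<s s≤R) ⟩
    f (P + (Q + s))                          ≡⟨ f≗ (m≤n⇒m≤o+n P 0<Q+s) ⟩
    ⟦ w₁ ++ w₂ ++ w₃ ++ w₄ ⟧ e (P + (Q + s)) ≡⟨ ⟦⟧-++-skip w₁ 0<Q+s ⟩
    ⟦ w₂ ++ w₃ ++ w₄ ⟧ e (Q + s)             ≡⟨ ⟦⟧-++-skip w₂ 0<s ⟩
    ⟦ w₃ ++ w₄ ⟧ e s                         ≡⟨ ⟦⟧-++-within w₃ 0<s s≤R ⟩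
    ⟦ w₃ ++ w₂ ++ w₄ ⟧ e s                   ≡⟨ ⟦⟧-++-skip w₁ 0<s ⟨
    ⟦ w₁ ++ w₃ ++ w₂ ++ w₄ ⟧ e (P + s)       ∎
    where
    0<Q+s : 0 < Q + s
    0<Q+s = m≤n⇒m≤o+n Q 0<s
  ...   | above {s′} 0<s′ with cut Q s′
  ...     | below s′≤Q = begin
    f (σ P (P + Q) (P + Q + R) (P + (R + s′)))  ≡⟨ cong f (σ-at-left-block P Q R 0<s′ s′≤Q) ⟩
    f (P + s′)                                  ≡⟨ f≗ (m≤n⇒m≤o+n P 0<s′) ⟩
    ⟦ w₁ ++ w₂ ++ w₃ ++ w₄ ⟧ e (P + s′)         ≡⟨ ⟦⟧-++-skip w₁ 0<s′ ⟩
    ⟦ w₂ ++ w₃ ++ w₄ ⟧ e s′                     ≡⟨ ⟦⟧-++-within w₂ 0<s′ s′≤Q ⟩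
    ⟦ w₂ ++ w₄ ⟧ e s′                           ≡⟨ ⟦⟧-++-skip w₃ 0<s′ ⟨
    ⟦ w₃ ++ w₂ ++ w₄ ⟧ e (R + s′)               ≡⟨ ⟦⟧-++-skip w₁ (m≤n⇒m≤o+n R 0<s′) ⟨
    ⟦ w₁ ++ w₃ ++ w₂ ++ w₄ ⟧ e (P + (R + s′))   ∎
  ...     | above {s″} 0<s″ = begin
    f (σ P (P + Q) (P + Q + R) (P + (R + (Q + s″)))) ≡⟨ cong f (σ-after-blocks P Q R 0<s″) ⟩
    f (P + (Q + (R + s″)))                          ≡⟨ f≗ (m≤n⇒m≤o+n P 0<Q+R+s″) ⟩
    ⟦ w₁ ++ w₂ ++ w₃ ++ w₄ ⟧ e (P + (Q + (R + s″))) ≡⟨ ⟦⟧-++-skip w₁ 0<Q+R+s″ ⟩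
    ⟦ w₂ ++ w₃ ++ w₄ ⟧ e (Q + (R + s″))             ≡⟨ ⟦⟧-++-skip w₂ (m≤n⇒m≤o+n R 0<s″) ⟩
    ⟦ w₃ ++ w₄ ⟧ e (R + s″)                         ≡⟨ ⟦⟧-++-skip w₃ 0<s″ ⟩
    ⟦ w₄ ⟧ e s″                                     ≡⟨ ⟦⟧-++-skip w₂ 0<s″ ⟨
    ⟦ w₂ ++ w₄ ⟧ e (Q + s″)                         ≡⟨ ⟦⟧-++-skip w₃ (m≤n⇒m≤o+n Q 0<s″) ⟨
    ⟦ w₃ ++ w₂ ++ w₄ ⟧ e (R + (Q + s″))             ≡⟨ ⟦⟧-++-skip w₁ (m≤n⇒m≤o+n R (m≤n⇒m≤o+n Q 0<s″)) ⟨
    ⟦ w₁ ++ w₃ ++ w₂ ++ w₄ ⟧ e (P + (R + (Q + s″))) ∎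
    where
    0<Q+R+s″ : 0 < Q + (R + s″)
    0<Q+R+s″ = m≤n⇒m≤o+n Q (m≤n⇒m≤o+n R 0<s″)

record SegmentExchange (n : ℕ) (π ρ : ℕ → ℕ) : Set where
  constructor exchange
  field
    w₁ w₂ w₃ w₄ : Word
    tail : ℕ
    0<span₂ : 0 < span w₂
    0<span₃ : 0 < span w₃
    fits : span w₁ + span w₂ + span w₃ ≤ n
    π-word : π ≗⁺ ⟦ w₁ ++ w₂ ++ w₃ ++ w₄ ⟧ tail
    ρ-word : ρ ≗⁺ ⟦ w₁ ++ w₃ ++ w₂ ++ w₄ ⟧ tail

exchange-sym : ∀ {n π ρ} → SegmentExchange n π ρ → SegmentExchange n ρ π
exchange-sym (exchange w₁ w₂ w₃ w₄ e 0<span₂ 0<span₃ fits π-word ρ-word) =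
  exchange w₁ w₃ w₂ w₄ e 0<span₃ 0<span₂
    (≤-trans (≤-reflexive (xy∙z≈xz∙y (span w₁) (span w₃) (span w₂))) fits) ρ-word π-word

exchange⇒Adj : ∀ {n π ρ} → SegmentExchange n π ρ → Adj n π ρ
exchange⇒Adj (exchange w₁ w₂ w₃ w₄ e 0<span₂ 0<span₃ fits π-word ρ-word) =
  P , P + Q , P + Q + R , (m<m+n P 0<span₂ , m<m+n (P + Q) 0<span₃ , fits) ,
  λ _ 0<t _ → trans (ρ-word 0<t) (sym (swap-≗⁺ w₁ w₂ w₃ w₄ π-word 0<t))
  where
  P Q R : ℕ
  P = span w₁
  Q = span w₂
  R = span w₃

-- σᵢⱼₖ-word is σ at the i-th, j-th and k-th of the boundaries a, a + b,
-- a + b + c, a + b + c + d.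
module FourSegments (a b c d : ℕ) where

  A B C D : Block
  A = (0 , a)
  B = (a , b)
  C = (a + b , c)
  D = (a + b + c , d)

  end : ℕ
  end = sum (a ∷ b ∷ c ∷ d ∷ [])

  identity-word : (λ t → t) ≗⁺ ⟦ A ∷ B ∷ C ∷ D ∷ [] ⟧ end
  identity-word = segments-translation 0 (a ∷ b ∷ c ∷ d ∷ [])

  σ₁₂₃-word : σ a (a + b) (a + b + c) ≗⁺ ⟦ A ∷ C ∷ B ∷ D ∷ [] ⟧ end
  σ₁₂₃-word = swap-≗⁺ (A ∷ []) (B ∷ []) (C ∷ []) (D ∷ []) identity-word

  σ₁₂₄-word : σ a (a + b) (a + b + c + d) ≗⁺ ⟦ A ∷ C ∷ D ∷ B ∷ [] ⟧ end
  σ₁₂₄-word = subst (λ k → σ a (a + b) k ≗⁺ ⟦ A ∷ C ∷ D ∷ B ∷ [] ⟧ end) (sym (+-assoc (a + b) c d))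
    (swap-≗⁺ (A ∷ []) (B ∷ []) (C ∷ D ∷ []) [] identity-word)

  σ₂₃₄-word : σ (a + b) (a + b + c) (a + b + c + d) ≗⁺ ⟦ A ∷ B ∷ D ∷ C ∷ [] ⟧ end
  σ₂₃₄-word = swap-≗⁺ (A ∷ B ∷ []) (C ∷ []) (D ∷ []) [] identity-word

  σ₁₃₄-word : σ a (a + b + c) (a + b + c + d) ≗⁺ ⟦ A ∷ D ∷ B ∷ C ∷ [] ⟧ end
  σ₁₃₄-word = subst (λ j → σ a j (j + d) ≗⁺ ⟦ A ∷ D ∷ B ∷ C ∷ [] ⟧ end) (sym (+-assoc a b c))
    (swap-≗⁺ (A ∷ []) (B ∷ C ∷ []) (D ∷ []) [] identity-word)

data Chain : ℕ → ℕ → ℕ → ℕ → Set where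
  chain : ∀ a {b c d} → 0 < b → 0 < c → 0 < d → Chain a (a + b) (a + b + c) (a + b + c + d)

<-chain : ∀ {p q r s} → p < q → q < r → r < s → Chain p q r s
<-chain {p} {q} {r} {s} p<q q<r r<s with cut p q | cut q r | cut r s
... | above 0<b | above 0<c | above 0<d = chain p 0<b 0<c 0<d
... | below q≤p | _         | _         = contradiction p<q (≤⇒≯ q≤p)
... | _         | below r≤q | _         = contradiction q<r (≤⇒≯ r≤q)
... | _         | _         | below s≤r = contradiction r<s (≤⇒≯ s≤r)

last-boundary-exchange : ∀ {n p q r s} → p < q → q < r → r < s → s ≤ n →
                         SegmentExchange n (σ p q r) (σ p q s)
last-boundary-exchange {n} p<q q<r r<s s≤n with <-chain p<q q<r r<s
... | chain a {b} {c} {d} 0<b _ 0<d =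
  exchange (A ∷ C ∷ []) (B ∷ []) (D ∷ []) [] end 0<b 0<d fits σ₁₂₃-word σ₁₂₄-word
  where
  open FourSegments a b c d
  fits : a + c + b + d ≤ n
  fits = ≤-trans (≤-reflexive (cong (_+ d) (xy∙z≈xz∙y a c b))) s≤n

shifted-exchange : ∀ {n p q r s} → p < q → q < r → r < s → s ≤ n →
                   SegmentExchange n (σ p q r) (σ q r s)
shifted-exchange {n} p<q q<r r<s s≤n with <-chain p<q q<r r<s
... | chain a {b} {c} {d} 0<b 0<c _ =
  exchange (A ∷ []) (C ∷ []) (B ∷ D ∷ []) [] end 0<c (m≤n⇒m≤n+o d 0<b) fits σ₁₂₃-word σ₂₃₄-word
  where
  open FourSegments a b c d
  rearranged : a + c + (b + d) ≡ a + b + c + d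
  rearranged = solve (a ∷ b ∷ c ∷ d ∷ [])
  fits : a + c + (b + d) ≤ n
  fits = ≤-trans (≤-reflexive rearranged) s≤n

first-boundary-exchange : ∀ {n p q r s} → p < q → q < r → r < s → s ≤ n →
                          SegmentExchange n (σ q r s) (σ p r s)
first-boundary-exchange {n} p<q q<r r<s s≤n with <-chain p<q q<r r<s
... | chain a {b} {c} {d} 0<b _ 0<d =
  exchange (A ∷ []) (B ∷ []) (D ∷ []) (C ∷ []) end 0<b 0<d fits σ₂₃₄-word σ₁₃₄-word
  where
  open FourSegments a b c d
  fits : a + b + d ≤ n
  fits = ≤-trans (+-monoˡ-≤ d (m≤m+n (a + b) c)) s≤n

middle-boundary-exchange : ∀ {n p q r s} → p < q → q < r → r < s → s ≤ n →
                           SegmentExchange n (σ p q s) (σ p r s)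
middle-boundary-exchange {n} p<q q<r r<s s≤n with <-chain p<q q<r r<s
... | chain a {b} {c} {d} 0<b 0<c 0<d =
  exchange (A ∷ []) (C ∷ []) (D ∷ B ∷ []) [] end 0<c (m≤n⇒m≤n+o b 0<d) fits σ₁₂₄-word σ₁₃₄-word
  where
  open FourSegments a b c d
  rearranged : a + c + (d + b) ≡ a + b + c + d
  rearranged = solve (a ∷ b ∷ c ∷ d ∷ [])
  fits : a + c + (d + b) ≤ n
  fits = ≤-trans (≤-reflexive rearranged) s≤n

lemma6 : (n i j k i′ j′ k′ : ℕ) → 1 ≤ n → IsBT n i j k → IsBT n i′ j′ k′ →
    ((i′ ≡ i × j′ ≡ j × k ≢ k′)
     ⊎ (i′ ≡ j × j′ ≡ k × k < k′)
     ⊎ (j′ ≡ j × k′ ≡ k × i ≢ i′)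
     ⊎ (j′ ≡ i × k′ ≡ j × i′ < i)
     ⊎ (i′ ≡ i × k′ ≡ k × j ≢ j′)) →
    Adj n (σ i j k) (σ i′ j′ k′)
lemma6 n i j k _ _ k′ _ (i<j , j<k , k≤n) (_ , j<k′ , k′≤n) (inj₁ (refl , refl , k≢k′))
  with <-cmp k k′
... | tri< k<k′ _ _ = exchange⇒Adj (last-boundary-exchange i<j j<k k<k′ k′≤n)
... | tri≈ _ k≡k′ _ = contradiction k≡k′ k≢k′
... | tri> _ _ k′<k = exchange⇒Adj (exchange-sym (last-boundary-exchange i<j j<k′ k′<k k≤n))
lemma6 n i j k _ _ k′ _ (i<j , j<k , _) (_ , _ , k′≤n) (inj₂ (inj₁ (refl , refl , k<k′))) =
  exchange⇒Adj (shifted-exchange i<j j<k k<k′ k′≤n)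
lemma6 n i j k i′ _ _ _ (i<j , j<k , k≤n) (i′<j , _ , _) (inj₂ (inj₂ (inj₁ (refl , refl , i≢i′))))
  with <-cmp i′ i
... | tri< i′<i _ _ = exchange⇒Adj (first-boundary-exchange i′<i i<j j<k k≤n)
... | tri≈ _ i′≡i _ = contradiction (sym i′≡i) i≢i′
... | tri> _ _ i<i′ = exchange⇒Adj (exchange-sym (first-boundary-exchange i<i′ i′<j j<k k≤n))
lemma6 n i j k i′ _ _ _ (i<j , j<k , k≤n) _ (inj₂ (inj₂ (inj₂ (inj₁ (refl , refl , i′<i))))) =
  exchange⇒Adj (exchange-sym (shifted-exchange i′<i i<j j<k k≤n))
lemma6 n i j k _ j′ _ _ (i<j , j<k , k≤n) (i<j′ , j′<k , _) (inj₂ (inj₂ (inj₂ (inj₂ (refl , refl , j≢j′)))))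
  with <-cmp j j′
... | tri< j<j′ _ _ = exchange⇒Adj (middle-boundary-exchange i<j j<j′ j′<k k≤n)
... | tri≈ _ j≡j′ _ = contradiction j≡j′ j≢j′
... | tri> _ _ j′<j = exchange⇒Adj (exchange-sym (middle-boundary-exchange i<j′ j′<j j<k k≤n))
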